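{- For each nonnegative integer $k$, $|\mathcal U_{2k+1}(132,231)|=C_k$, where $C_k=\frac{1}{k+1}\binom{2k}{k}$.
   Context: The stack-sorting map $s$ on permutations (finite words of distinct positive integers): $s(\text{empty})=\text{empty}$, and if $\pi=LnR$ with $n$ the largest entry, $s(\pi)=s(L)s(R)n$. A permutation is uniquely sorted if it has exactly one preimage under $s$. A permutation avoids $\tau$ if no subsequence has the same relative order as $\tau$; $\mathcal U_n(\tau^{(1)},\tau^{(2)})$ is the set of uniquely sorted permutations of $[n]$ avoiding both patterns. -}

module Defs where

open import Data.Nat using (ℕ; zero; suc; _+_; _*_; _<_; _⊔_; _≟_)
open import Data.Nat.Combinatorics using (_C_)
open import Data.Nat.DivMod using (_/_)
open import Data.List using (List; []; _∷_; _++_; length; map; upTo; foldr; span; lookup)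
open import Data.List.Relation.Binary.Sublist.Propositional using (_⊆_)
open import Data.List.Relation.Binary.Permutation.Propositional using (_↭_)
open import Data.List.Relation.Unary.Unique.Propositional using (Unique)
open import Data.List.Membership.Propositional using (_∈_)
open import Data.Fin using (Fin; cast)
open import Data.Product using (Σ; _×_; _,_; ∃)
open import Function.Bundles using (_⇔_)
open import Relation.Nullary using (¬_; ¬?)
open import Relation.Binary.PropositionalEquality using (_≡_)

range : ℕ → List ℕ
range n = map suc (upTo n)

IsPerm : ℕ → List ℕ → Set
IsPerm n π = π ↭ range n

maxEntry : List ℕ → ℕ
maxEntry = foldr _⊔_ 0

-- stack-sorting map, s(empty)=empty, s(L n R) = s(L) s(R) n with n the
-- largest entry.  The fuel argument is the length of the word, which
-- strictly decreases in the recursive calls, so it never runs out.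
stackSortFuel : ℕ → List ℕ → List ℕ
stackSortFuel zero π = π
stackSortFuel (suc f) [] = []
stackSortFuel (suc f) (x ∷ xs) with span (λ y → ¬? (y ≟ maxEntry (x ∷ xs))) (x ∷ xs)
... | (L , []) = L
... | (L , n ∷ R) = stackSortFuel f L ++ stackSortFuel f R ++ (n ∷ [])

s : List ℕ → List ℕ
s π = stackSortFuel (length π) π

UniquelySorted : ℕ → List ℕ → Set
UniquelySorted n π =
  Σ (List ℕ) λ σ → (IsPerm n σ × s σ ≡ π) ×
    ((τ : List ℕ) → IsPerm n τ → s τ ≡ π → τ ≡ σ)

OrderIso : List ℕ → List ℕ → Set
OrderIso σ τ = Σ (length σ ≡ length τ) λ eq →
  (i j : Fin (length σ)) →
    (lookup σ i < lookup σ j) ⇔ (lookup τ (cast eq i) < lookup τ (cast eq j))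

Contains : List ℕ → List ℕ → Set
Contains π τ = Σ (List ℕ) λ σ → σ ⊆ π × OrderIso σ τ

Avoids : List ℕ → List ℕ → Set
Avoids π τ = ¬ Contains π τ

p132 p231 : List ℕ
p132 = 1 ∷ 3 ∷ 2 ∷ []
p231 = 2 ∷ 3 ∷ 1 ∷ []

InU : ℕ → List ℕ → List ℕ → List ℕ → Set
InU n τ₁ τ₂ π = IsPerm n π × UniquelySorted n π × Avoids π τ₁ × Avoids π τ₂

HasCardinality : (List ℕ → Set) → ℕ → Set
HasCardinality P m = Σ (List (List ℕ)) λ xs →
  Unique xs × length xs ≡ m × ((π : List ℕ) → (π ∈ xs) ⇔ P π)

catalan : ℕ → ℕ
catalan k = ((2 * k) C k) / suc k

-- A permutation avoids 132 and 231 exactly when it has no peak, i.e. when it is a valley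
-- D m I: a decreasing word D, its minimum m, then an increasing word I.  Since s ends every
-- word with its maximum, a preimage of a valley whose last entry M is the maximum has the form
-- M R, d M R with d the head of D, or L M R with m in s L.  Induction on the length then shows
-- that the valley has a preimage iff, for every u, I has at least as many entries above u as D
-- (a ballot condition), exactly one iff moreover |D| = |I|, and at least two otherwise.
-- Recording for each of the values 2k+1, 2k, ..., 2 whether it lies in D or in I turns the
-- uniquely sorted valleys of [2k+1] into the Dyck words of length 2k, and there are
-- C(2k,k) - C(2k,k-1) = C_k of those.
module Submission where

open import Data.Bool using (Bool; true; false; T)
open import Data.Nat
  using (ℕ; zero; suc; _+_; _*_; _∸_; _≤_; _<_; _>_; _≟_; _<?_; _≡ᵇ_; z≤n; s≤s; s≤s⁻¹; s<s⁻¹; z<s)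
open import Data.Empty using (⊥; ⊥-elim)
open import Data.Fin using (Fin; zero; suc)
open import Data.List using (List; []; _∷_; _++_; length; span; filter; map; upTo; initLast; _∷ʳ′_)
open import Data.List.Properties
  using ( ++-assoc; ++-identityʳ; ++-conicalʳ; ∷-injective; ∷-injectiveʳ; ∷ʳ-injective; ∷ʳ-injectiveˡ
        ; length-++; length-map; length-upTo; map-++; upTo-∷ʳ
        ; filter-++; length-filter; filter-all; filter-none; filter-accept)
open import Data.List.Membership.Propositional using (_∈_)
open import Data.List.Membership.Propositional.Properties
  using (∈-++⁺ˡ; ∈-++⁺ʳ; ∈-++⁻; ∈-map⁺; ∈-map⁻; ∈-upTo⁺; ∈-upTo⁻)
open import Data.List.Relation.Binary.Disjoint.Propositional {A = ℕ} using (Disjoint; contractₗ)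
open import Data.List.Relation.Binary.Permutation.Propositional
  using (_↭_; ↭-refl; ↭-sym; ↭-trans; ↭-reflexive; ↭⇒↭ₛ; module PermutationReasoning)
open import Data.List.Relation.Binary.Permutation.Propositional.Properties
  using (All-resp-↭; ∈-resp-↭; ++⁺; ++⁺ˡ; ++⁺ʳ; ∷↭∷ʳ; ↭-singleton-inv; ↭-length; drop-mid)
import Data.List.Relation.Binary.Permutation.Setoid.Properties as Permₛ
open import Data.List.Relation.Binary.Sublist.Heterogeneous using (toAny; fromAny)
open import Data.List.Relation.Binary.Sublist.Propositional using (_⊆_; _∷_; _∷ʳ_)
open import Data.List.Relation.Binary.Sublist.Propositional.Properties using (∷ˡ⁻)
open import Data.List.Relation.Unary.All as All using (All; []; _∷_)
import Data.List.Relation.Unary.All.Properties as Allₚ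
open import Data.List.Relation.Unary.AllPairs as AllPairs using (AllPairs; []; _∷_)
import Data.List.Relation.Unary.AllPairs.Properties as AllPairsₚ
open import Data.List.Relation.Unary.Any using (here; there)
open import Data.List.Relation.Unary.Unique.Propositional using (Unique)
import Data.List.Relation.Unary.Unique.Propositional.Properties as Uniqueₚ
open import Data.Nat.Combinatorics using (_C_; nCk+nC[k+1]≡[n+1]C[k+1]; nCk≡nC[n∸k]; nC1≡n; nCn≡1)
open import Data.Nat.DivMod using (_/_; m*n/n≡m)
open import Data.Nat.Properties
open import Data.Nat.Tactic.RingSolver using (solve-∀)
open import Data.Product using (∃; ∃₂; _×_; _,_; proj₁; proj₂)
open import Data.Sum using (_⊎_; inj₁; inj₂)
open import Data.Unit using (tt)
open import Function.Bundles using (_⇔_; mk⇔; Equivalence)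
open import Relation.Binary.Definitions using (tri<; tri≈; tri>)
open import Relation.Binary.PropositionalEquality
open import Relation.Nullary using (¬_; ¬?; yes; no)

open import Defs

-- The stack-sorting map

breakAt : ℕ → List ℕ → List ℕ × List ℕ
breakAt n = span (λ y → ¬? (y ≟ n))

data BreakView (n : ℕ) (xs : List ℕ) : List ℕ × List ℕ → Set where
  absent  : All (_≢ n) xs → BreakView n xs (xs , [])
  present : ∀ L R → xs ≡ L ++ n ∷ R → All (_≢ n) L → BreakView n xs (L , n ∷ R)

≡ᵇ-false⇒≢ : ∀ {x n} → (x ≡ᵇ n) ≡ false → x ≢ n
≡ᵇ-false⇒≢ {x} {n} eq x≡n = subst T eq (≡⇒≡ᵇ x n x≡n)

breakView : ∀ n xs → BreakView n xs (breakAt n xs)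
breakView n [] = absent []
breakView n (x ∷ xs) with x ≡ᵇ n in eq
... | true with ≡ᵇ⇒≡ x n (subst T (sym eq) tt)
...   | refl = present [] xs refl []
breakView n (x ∷ xs) | false with breakAt n xs | breakView n xs
... | _ | absent ≢n = absent (≡ᵇ-false⇒≢ eq ∷ ≢n)
... | _ | present L R xs≡ ≢n = present (x ∷ L) R (cong (x ∷_) xs≡) (≡ᵇ-false⇒≢ eq ∷ ≢n)

sortAround : ℕ → List ℕ × List ℕ → List ℕ
sortAround f (L , []) = L
sortAround f (L , n ∷ R) = stackSortFuel f L ++ stackSortFuel f R ++ n ∷ []

stackSortFuel-∷ : ∀ f x xs →
  stackSortFuel (suc f) (x ∷ xs) ≡ sortAround f (breakAt (maxEntry (x ∷ xs)) (x ∷ xs))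
stackSortFuel-∷ f x xs with breakAt (maxEntry (x ∷ xs)) (x ∷ xs)
... | (L , []) = refl
... | (L , n ∷ R) = refl

stackSortFuel-[] : ∀ f → stackSortFuel f [] ≡ []
stackSortFuel-[] zero = refl
stackSortFuel-[] (suc f) = refl

split-shorter : ∀ {x xs} L (n : ℕ) R → x ∷ xs ≡ L ++ n ∷ R → length L ≤ length xs × length R ≤ length xs
split-shorter {x} {xs} L n R split = subst (length L ≤_) sum≡ (m≤m+n _ _) , subst (length R ≤_) sum≡ (m≤n+m _ _)
  where
    sum≡ : length L + length R ≡ length xs
    sum≡ = suc-injective (begin
      suc (length L + length R) ≡⟨ +-suc (length L) (length R) ⟨
      length L + length (n ∷ R) ≡⟨ length-++ L ⟨
      length (L ++ n ∷ R)       ≡⟨ cong length split ⟨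
      length (x ∷ xs)           ∎)
      where open ≡-Reasoning

stackSortFuel-irrelevant : ∀ f g xs → length xs ≤ f → length xs ≤ g →
  stackSortFuel f xs ≡ stackSortFuel g xs
stackSortFuel-irrelevant f g [] _ _ = trans (stackSortFuel-[] f) (sym (stackSortFuel-[] g))
stackSortFuel-irrelevant (suc f) (suc g) (x ∷ xs) (s≤s xs≤f) (s≤s xs≤g)
  with breakAt (maxEntry (x ∷ xs)) (x ∷ xs) | breakView (maxEntry (x ∷ xs)) (x ∷ xs)
     | stackSortFuel-∷ f x xs | stackSortFuel-∷ g x xs
... | _ | absent _ | unfold-f | unfold-g = trans unfold-f (sym unfold-g)
... | _ | present L R split _ | unfold-f | unfold-g with split-shorter L _ R split
...   | L≤ , R≤ =
  trans unfold-f (trans (cong₂ _++_ (irrelevant L L≤) (cong (_++ _) (irrelevant R R≤))) (sym unfold-g))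
  where
    irrelevant : ∀ ys → length ys ≤ length xs → stackSortFuel f ys ≡ stackSortFuel g ys
    irrelevant ys ys≤ = stackSortFuel-irrelevant f g ys (≤-trans ys≤ xs≤f) (≤-trans ys≤ xs≤g)

stackSortFuel≡s : ∀ f xs → length xs ≤ f → stackSortFuel f xs ≡ s xs
stackSortFuel≡s f xs xs≤f = stackSortFuel-irrelevant f (length xs) xs xs≤f ≤-refl

maxEntry-upper : ∀ xs → All (_≤ maxEntry xs) xs
maxEntry-upper [] = []
maxEntry-upper (x ∷ xs) =
  m≤m⊔n x (maxEntry xs) ∷ All.map (λ y≤ → ≤-trans y≤ (m≤n⊔m x (maxEntry xs))) (maxEntry-upper xs)

maxEntry-∈ : ∀ x xs → maxEntry (x ∷ xs) ∈ x ∷ xs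
maxEntry-∈ x [] = here (⊔-identityʳ x)
maxEntry-∈ x (y ∷ xs) with ⊔-sel x (maxEntry (y ∷ xs))
... | inj₁ max≡x = here max≡x
... | inj₂ max≡rest = there (subst (_∈ y ∷ xs) (sym max≡rest) (maxEntry-∈ y xs))

record MaxSplit (xs : List ℕ) : Set where
  constructor maxSplit
  field
    left  : List ℕ
    top   : ℕ
    right : List ℕ
    split : xs ≡ left ++ top ∷ right
    first : All (_≢ top) left
    upper : All (_≤ top) xs
    sorts : s xs ≡ s left ++ s right ++ top ∷ []

s-maxSplit : ∀ x xs → MaxSplit (x ∷ xs)
s-maxSplit x xs = fromView (breakView M (x ∷ xs)) (stackSortFuel-∷ (length xs) x xs)
  where
    M = maxEntry (x ∷ xs)
    fromView : ∀ {p} → BreakView M (x ∷ xs) p → s (x ∷ xs) ≡ sortAround (length xs) p →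
               MaxSplit (x ∷ xs)
    fromView (absent ≢M) _ = ⊥-elim (All.lookup ≢M (maxEntry-∈ x xs) refl)
    fromView (present L R split first) unfold with split-shorter L M R split
    ... | L≤ , R≤ = maxSplit L M R split first (maxEntry-upper (x ∷ xs))
      (trans unfold (cong₂ _++_ (stackSortFuel≡s _ L L≤) (cong (_++ _) (stackSortFuel≡s _ R R≤))))

s-↭-bounded : ∀ k xs → length xs ≤ k → s xs ↭ xs
s-↭-bounded k [] _ = ↭-refl
s-↭-bounded (suc k) (x ∷ xs) (s≤s xs≤k) with s-maxSplit x xs
... | maxSplit L n R split _ _ sorts with split-shorter L n R split
...   | L≤ , R≤ = begin
  s (x ∷ xs)        ≡⟨ sorts ⟩
  s L ++ s R ++ n ∷ [] ↭⟨ ++⁺ (recurse L L≤) (++⁺ʳ (n ∷ []) (recurse R R≤)) ⟩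
  L ++ R ++ n ∷ []  ↭⟨ ++⁺ˡ L (↭-sym (∷↭∷ʳ n R)) ⟩
  L ++ n ∷ R        ≡⟨ split ⟨
  x ∷ xs            ∎
  where
    open PermutationReasoning
    recurse : ∀ ys → length ys ≤ length xs → s ys ↭ ys
    recurse ys ys≤ = s-↭-bounded k ys (≤-trans ys≤ xs≤k)

s-↭ : ∀ xs → s xs ↭ xs
s-↭ xs = s-↭-bounded (length xs) xs ≤-refl

s≡[x]⇒≡[x] : ∀ {τ x} → s τ ≡ x ∷ [] → τ ≡ x ∷ []
s≡[x]⇒≡[x] {τ} sτ≡ = ↭-singleton-inv (↭-trans (↭-sym (s-↭ τ)) (↭-reflexive sτ≡))

++-∷-first-injective : ∀ {M : ℕ} L R L′ R′ → All (_≢ M) L → All (_≢ M) L′ →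
  L ++ M ∷ R ≡ L′ ++ M ∷ R′ → L ≡ L′ × R ≡ R′
++-∷-first-injective [] R [] R′ _ _ refl = refl , refl
++-∷-first-injective [] R (x ∷ L′) R′ _ (x≢M ∷ _) eq = ⊥-elim (x≢M (sym (proj₁ (∷-injective eq))))
++-∷-first-injective (x ∷ L) R [] R′ (x≢M ∷ _) _ eq = ⊥-elim (x≢M (proj₁ (∷-injective eq)))
++-∷-first-injective (x ∷ L) R (y ∷ L′) R′ (_ ∷ ≢L) (_ ∷ ≢L′) eq with ∷-injective eq
... | refl , eq′ with ++-∷-first-injective L R L′ R′ ≢L ≢L′ eq′
...   | refl , refl = refl , refl

maxSplit-++-∷ : ∀ L M R → MaxSplit (L ++ M ∷ R)
maxSplit-++-∷ [] M R = s-maxSplit M R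
maxSplit-++-∷ (x ∷ L) M R = s-maxSplit x (L ++ M ∷ R)

s-++-∷ : ∀ {M} L R → All (_< M) L → All (_< M) R → s (L ++ M ∷ R) ≡ s L ++ s R ++ M ∷ []
s-++-∷ {M} L R L<M R<M with maxSplit-++-∷ L M R
... | maxSplit L′ n R′ split first upper sorts with ≤-antisym n≤M M≤n
  where
    ≤M : All (_≤ M) (L ++ M ∷ R)
    ≤M = Allₚ.++⁺ (All.map <⇒≤ L<M) (≤-refl ∷ All.map <⇒≤ R<M)
    n≤M : n ≤ M
    n≤M = All.lookup ≤M (subst (n ∈_) (sym split) (∈-++⁺ʳ L′ (here refl)))
    M≤n : M ≤ n
    M≤n = All.lookup upper (∈-++⁺ʳ L (here refl))
...   | refl with ++-∷-first-injective L R L′ R′ (All.map <⇒≢ L<M) first split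
...     | refl , refl = sorts

s-[x] : ∀ x → s (x ∷ []) ≡ x ∷ []
s-[x] x = s-++-∷ [] [] [] []

s≡∷ʳ-split : ∀ τ W M → s τ ≡ W ++ M ∷ [] →
  ∃₂ λ L R → τ ≡ L ++ M ∷ R × s L ++ s R ≡ W × All (_≤ M) τ
s≡∷ʳ-split [] [] M ()
s≡∷ʳ-split [] (_ ∷ _) M ()
s≡∷ʳ-split (x ∷ xs) W M sτ≡ with s-maxSplit x xs
... | maxSplit L n R split _ upper sorts with ∷ʳ-injective (s L ++ s R) W (begin
    (s L ++ s R) ++ n ∷ [] ≡⟨ ++-assoc (s L) (s R) (n ∷ []) ⟩
    s L ++ s R ++ n ∷ []   ≡⟨ sorts ⟨
    s (x ∷ xs)             ≡⟨ sτ≡ ⟩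
    W ++ M ∷ []            ∎)
  where open ≡-Reasoning
...   | sLR≡W , refl = L , R , split , sLR≡W , upper

s≡∷ʳ⇒upper : ∀ τ W M → s τ ≡ W ++ M ∷ [] → All (_≤ M) W
s≡∷ʳ⇒upper τ W M sτ≡ =
  let (_ , _ , _ , _ , τ≤M) = s≡∷ʳ-split τ W M sτ≡
  in Allₚ.++⁻ˡ W (subst (All (_≤ M)) sτ≡ (All-resp-↭ (↭-sym (s-↭ τ)) τ≤M))

-- Valleys and the ballot condition

AllPairs-++⁻ˡ : ∀ {R : ℕ → ℕ → Set} xs {ys} → AllPairs R (xs ++ ys) → AllPairs R xs
AllPairs-++⁻ˡ [] _ = []
AllPairs-++⁻ˡ (x ∷ xs) (Rx ∷ R-rest) = Allₚ.++⁻ˡ xs Rx ∷ AllPairs-++⁻ˡ xs R-rest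

AllPairs-∷ʳ⁻ : ∀ {R : ℕ → ℕ → Set} xs {y} → AllPairs R (xs ++ y ∷ []) → All (λ x → R x y) xs
AllPairs-∷ʳ⁻ [] _ = []
AllPairs-∷ʳ⁻ (x ∷ xs) (Rx ∷ R-rest) = All.head (Allₚ.++⁻ʳ xs Rx) ∷ AllPairs-∷ʳ⁻ xs R-rest

record Valley (D : List ℕ) (m : ℕ) (I : List ℕ) : Set where
  constructor valley
  field
    decreasing : AllPairs _>_ D
    increasing : AllPairs _<_ I
    left>min   : All (m <_) D
    right>min  : All (m <_) I

#above : ℕ → List ℕ → ℕ
#above u xs = length (filter (u <?_) xs)

#above-++ : ∀ u xs ys → #above u (xs ++ ys) ≡ #above u xs + #above u ys
#above-++ u xs ys = trans (cong length (filter-++ (u <?_) xs ys)) (length-++ (filter (u <?_) xs))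

#above-≤ : ∀ {u xs} → All (_≤ u) xs → #above u xs ≡ 0
#above-≤ {u} xs≤u = cong length (filter-none (u <?_) (All.map (λ x≤u u<x → <⇒≱ u<x x≤u) xs≤u))

#above-< : ∀ {u d xs} → All (_< d) xs → d ≤ u → #above u xs ≡ 0
#above-< xs<d d≤u = #above-≤ (All.map (λ x<d → ≤-trans (<⇒≤ x<d) d≤u) xs<d)

#above-> : ∀ {u xs} → All (u <_) xs → #above u xs ≡ length xs
#above-> {u} u<xs = cong length (filter-all (u <?_) u<xs)

#above-∷-< : ∀ {u x} xs → u < x → #above u (x ∷ xs) ≡ suc (#above u xs)
#above-∷-< {u} xs u<x = cong length (filter-accept (u <?_) u<x)

#above-∷ʳ-< : ∀ {u M} xs → u < M → #above u (xs ++ M ∷ []) ≡ suc (#above u xs)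
#above-∷ʳ-< {u} {M} xs u<M = begin
  #above u (xs ++ M ∷ [])            ≡⟨ #above-++ u xs (M ∷ []) ⟩
  #above u xs + #above u (M ∷ [])    ≡⟨ cong (#above u xs +_) (#above-∷-< [] u<M) ⟩
  #above u xs + 1                    ≡⟨ +-comm (#above u xs) 1 ⟩
  suc (#above u xs)                  ∎
  where open ≡-Reasoning

#above-∷ʳ-≤ : ∀ u xs {v} → #above u (xs ++ v ∷ []) ≤ suc (#above u xs)
#above-∷ʳ-≤ u xs {v} = begin
  #above u (xs ++ v ∷ [])          ≡⟨ #above-++ u xs (v ∷ []) ⟩
  #above u xs + #above u (v ∷ [])  ≤⟨ +-monoʳ-≤ (#above u xs) (length-filter (u <?_) (v ∷ [])) ⟩
  #above u xs + 1                  ≡⟨ +-comm (#above u xs) 1 ⟩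
  suc (#above u xs)                ∎
  where open ≤-Reasoning

BallotBy : ℕ → List ℕ → List ℕ → Set
BallotBy h D I = ∀ u → #above u D ≤ #above u I + h

ballotBy-∷ʳ⁺ : ∀ {h v} D I → All (_< v) D → BallotBy (suc h) D I → BallotBy h D (I ++ v ∷ [])
ballotBy-∷ʳ⁺ {h} {v} D I D<v ballot u with u <? v
... | yes u<v =
  subst (#above u D ≤_) (trans (+-suc (#above u I) h) (cong (_+ h) (sym (#above-∷ʳ-< I u<v)))) (ballot u)
... | no u≮v =
  subst (_≤ #above u (I ++ v ∷ []) + h) (sym (#above-< D<v (≮⇒≥ u≮v))) z≤n

ballotBy-∷ʳ⁻ : ∀ {h v} D I → BallotBy h D (I ++ v ∷ []) → BallotBy (suc h) D I
ballotBy-∷ʳ⁻ {h} {v} D I ballot u = ≤-trans (ballot u)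
  (subst (#above u (I ++ v ∷ []) + h ≤_) (sym (+-suc (#above u I) h)) (+-monoˡ-≤ h (#above-∷ʳ-≤ u I)))

ballotBy-∷⁺ : ∀ {h v} D I → All (_< v) D → BallotBy h D I → BallotBy (suc h) (v ∷ D) I
ballotBy-∷⁺ {h} {v} D I D<v ballot u with u <? v
... | yes u<v = subst₂ _≤_ (sym (#above-∷-< D u<v)) (sym (+-suc (#above u I) h)) (s≤s (ballot u))
... | no u≮v =
  subst (_≤ #above u I + suc h) (sym (#above-≤ (v≤u ∷ All.map (λ x<v → ≤-trans (<⇒≤ x<v) v≤u) D<v))) z≤n
  where v≤u = ≮⇒≥ u≮v

ballotBy-∷⁻ : ∀ {h v} D I → All (_< v) D → BallotBy (suc h) (v ∷ D) I → BallotBy h D I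
ballotBy-∷⁻ {h} {v} D I D<v ballot u with u <? v
... | yes u<v = s≤s⁻¹ (subst₂ _≤_ (#above-∷-< D u<v) (+-suc (#above u I) h) (ballot u))
... | no u≮v =
  subst (_≤ #above u I + h) (sym (#above-< D<v (≮⇒≥ u≮v))) z≤n

¬ballotBy-0-∷ : ∀ {w} D I → All (_≤ w) I → ¬ BallotBy 0 (suc w ∷ D) I
¬ballotBy-0-∷ {w} D I I≤w ballot
  with subst₂ _≤_ (#above-∷-< D (n<1+n w)) (trans (+-identityʳ _) (#above-≤ I≤w)) (ballot w)
... | ()

Ballot : List ℕ → List ℕ → Set
Ballot D I = ∀ u → #above u D ≤ #above u I

ballot-[]ˡ : ∀ I → Ballot [] I
ballot-[]ˡ I u = z≤n

ballot-++ʳ : ∀ D X Y → Ballot D X → Ballot D (X ++ Y)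
ballot-++ʳ D X Y ballot u =
  ≤-trans (ballot u) (subst (#above u X ≤_) (sym (#above-++ u X Y)) (m≤m+n _ _))

ballot⇒ballotBy0 : ∀ D I → Ballot D I → BallotBy 0 D I
ballot⇒ballotBy0 D I ballot u = subst (#above u D ≤_) (sym (+-identityʳ _)) (ballot u)

ballotBy0⇒ballot : ∀ D I → BallotBy 0 D I → Ballot D I
ballotBy0⇒ballot D I ballot u = subst (#above u D ≤_) (+-identityʳ _) (ballot u)

ballot-∷-∷ʳ⁺ : ∀ {d M} D I → d < M → All (_< d) D → Ballot D I → Ballot (d ∷ D) (I ++ M ∷ [])
ballot-∷-∷ʳ⁺ {d} {M} D I d<M D<d ballot = ballotBy0⇒ballot (d ∷ D) (I ++ M ∷ [])
  (ballotBy-∷ʳ⁺ (d ∷ D) I (d<M ∷ All.map (λ x<d → <-trans x<d d<M) D<d)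
    (ballotBy-∷⁺ D I D<d (ballot⇒ballotBy0 D I ballot)))

ballot-∷-∷ʳ⁻ : ∀ {d M} D I → All (_< d) D → Ballot (d ∷ D) (I ++ M ∷ []) → Ballot D I
ballot-∷-∷ʳ⁻ {d} {M} D I D<d ballot =
  ballotBy0⇒ballot D I (ballotBy-∷⁻ D I D<d
    (ballotBy-∷ʳ⁻ (d ∷ D) I (ballot⇒ballotBy0 (d ∷ D) (I ++ M ∷ []) ballot)))

ballot⇒length≤ : ∀ {m D I} → All (m <_) D → All (m <_) I → Ballot D I → length D ≤ length I
ballot⇒length≤ {m} m<D m<I ballot = subst₂ _≤_ (#above-> m<D) (#above-> m<I) (ballot m)

ballot-head< : ∀ {d M} D I → All (_< M) I → d ≢ M → Ballot (d ∷ D) (I ++ M ∷ []) → d < M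
ballot-head< {d} {M} D I I<M d≢M ballot with <-cmp d M
... | tri< d<M _ _ = d<M
... | tri≈ _ d≡M _ = ⊥-elim (d≢M d≡M)
... | tri> _ _ M<d =
  ⊥-elim (<⇒≱ (subst (0 <_) (sym (#above-∷-< D M<d)) z<s) (subst (_ ≤_) nothing-above-M (ballot M)))
  where
    nothing-above-M : #above M (I ++ M ∷ []) ≡ 0
    nothing-above-M = #above-≤ (Allₚ.++⁺ (All.map <⇒≤ I<M) (≤-refl ∷ []))

-- Preimages of a valley

All-preimage : ∀ {P : ℕ → Set} {ρ W} → s ρ ≡ W → All P W → All P ρ
All-preimage {ρ = ρ} sρ≡W PW = All-resp-↭ (s-↭ ρ) (subst (All _) (sym sρ≡W) PW)

s≢decreasing : ∀ τ {a} xs → xs ≢ [] → All (_< a) xs → s τ ≢ a ∷ xs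
s≢decreasing τ xs xs≢[] xs<a sτ≡ with initLast xs
... | [] = xs≢[] refl
... | W ∷ʳ′ y = <⇒≱ (proj₂ (Allₚ.∷ʳ⁻ xs<a)) (All.head (s≡∷ʳ⇒upper τ (_ ∷ W) y sτ≡))

++≡++-∷-cases : ∀ (xs ys zs : List ℕ) m ws → xs ++ ys ≡ zs ++ m ∷ ws →
  (∃ λ X → zs ≡ xs ++ X × ys ≡ X ++ m ∷ ws) ⊎ (∃ λ X → xs ≡ zs ++ m ∷ X × ws ≡ X ++ ys)
++≡++-∷-cases [] ys zs m ws eq = inj₁ (zs , refl , eq)
++≡++-∷-cases (x ∷ xs) ys [] m ws eq with ∷-injective eq
... | refl , eq′ = inj₂ (xs , refl , sym eq′)
++≡++-∷-cases (x ∷ xs) ys (z ∷ zs) m ws eq with ∷-injective eq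
... | refl , eq′ with ++≡++-∷-cases xs ys zs m ws eq′
...   | inj₁ (X , zs≡ , ys≡) = inj₁ (X , cong (x ∷_) zs≡ , ys≡)
...   | inj₂ (X , xs≡ , ws≡) = inj₂ (X , cong (x ∷_) xs≡ , ws≡)

-- In a preimage L M R, s L ends with the maximum of L while D decreases, so s L cannot
-- consist of two or more entries of D.
data PreimageShape (D : List ℕ) (m : ℕ) (I : List ℕ) (M : ℕ) (τ : List ℕ) : Set where
  max-first     : ∀ R → s R ≡ D ++ m ∷ I → PreimageShape D m I M τ
  max-second    : ∀ d D′ R → D ≡ d ∷ D′ → τ ≡ d ∷ M ∷ R → d ≤ M → s R ≡ D′ ++ m ∷ I →
                  PreimageShape D m I M τ
  max-after-min : ∀ L R X → I ≡ X ++ s R → s L ≡ D ++ m ∷ X → PreimageShape D m I M τ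

preimageShape : ∀ D m I M τ → AllPairs _>_ D → s τ ≡ D ++ m ∷ I ++ M ∷ [] → PreimageShape D m I M τ
preimageShape D m I M τ dec sτ≡
  with s≡∷ʳ-split τ (D ++ m ∷ I) M (trans sτ≡ (sym (++-assoc D (m ∷ I) (M ∷ []))))
... | L , R , τ≡ , sLR≡ , τ≤M = cases (s L) refl sLR≡
  where
    cases : ∀ SL → s L ≡ SL → SL ++ s R ≡ D ++ m ∷ I → PreimageShape D m I M τ
    cases [] sL≡ sR≡ = max-first R sR≡
    cases (a ∷ rest) sL≡ sLR≡ with ++≡++-∷-cases (a ∷ rest) (s R) D m I sLR≡
    ... | inj₂ (X , sL≡D++m∷X , I≡) = max-after-min L R X I≡ (trans sL≡ sL≡D++m∷X)
    cases (a ∷ []) sL≡ _ | inj₁ (X , D≡ , sR≡) =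
      max-second a X R D≡ τ≡aMR (All.head (subst (All (_≤ M)) τ≡aMR τ≤M)) sR≡
      where τ≡aMR = subst (λ L → τ ≡ L ++ M ∷ R) (s≡[x]⇒≡[x] sL≡) τ≡
    cases (a ∷ b ∷ Z) sL≡ _ | inj₁ (X , D≡ , _) =
      ⊥-elim (s≢decreasing L (b ∷ Z) (λ ())
        (AllPairs.head (AllPairs-++⁻ˡ (a ∷ b ∷ Z) (subst (AllPairs _>_) D≡ dec))) sL≡)

UniquePreimage : List ℕ → Set
UniquePreimage W = ∃ λ σ → s σ ≡ W × (∀ τ → s τ ≡ W → τ ≡ σ)

TwoPreimages : List ℕ → Set
TwoPreimages W = ∃₂ λ τ₁ τ₂ → s τ₁ ≡ W × s τ₂ ≡ W × τ₁ ≢ τ₂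

record Preimages (D : List ℕ) (m : ℕ) (I : List ℕ) : Set where
  field
    ballot-necessary   : ∀ τ → s τ ≡ D ++ m ∷ I → Ballot D I
    unique-if-balanced : Ballot D I → length D ≡ length I → UniquePreimage (D ++ m ∷ I)
    two-if-unbalanced  : Ballot D I → length D < length I → TwoPreimages (D ++ m ∷ I)

preimage-exists : ∀ {D m I} → Valley D m I → Preimages D m I → Ballot D I → ∃ λ σ → s σ ≡ D ++ m ∷ I
preimage-exists (valley _ _ m<D m<I) P ballot with m≤n⇒m<n∨m≡n (ballot⇒length≤ m<D m<I ballot)
... | inj₁ shorter = let (τ , _ , sτ≡ , _) = Preimages.two-if-unbalanced P ballot shorter in τ , sτ≡
... | inj₂ balanced = let (σ , sσ≡ , _) = Preimages.unique-if-balanced P ballot balanced in σ , sσ≡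

length-∷ʳ : ∀ (xs : List ℕ) {x} → length (xs ++ x ∷ []) ≡ suc (length xs)
length-∷ʳ xs = trans (length-++ xs) (+-comm (length xs) 1)

valley-∷ʳ⁻ : ∀ {D m I M} → Valley D m (I ++ M ∷ []) → Valley D m I × All (_< M) I × m < M
valley-∷ʳ⁻ {I = I} (valley dec inc m<D m<I) =
  valley dec (AllPairs-++⁻ˡ I inc) m<D (Allₚ.++⁻ˡ I m<I) , AllPairs-∷ʳ⁻ I inc , All.head (Allₚ.++⁻ʳ I m<I)

valley-tailˡ : ∀ {d D m I} → Valley (d ∷ D) m I → Valley D m I
valley-tailˡ (valley (_ ∷ dec) inc (_ ∷ m<D) m<I) = valley dec inc m<D m<I

valley-prefixʳ : ∀ {D m} X {Y} → Valley D m (X ++ Y) → Valley D m X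
valley-prefixʳ X (valley dec inc m<D m<I) = valley dec (AllPairs-++⁻ˡ X inc) m<D (Allₚ.++⁻ˡ X m<I)

disjoint-prefixʳ : ∀ {D} X {Y} → Disjoint D (X ++ Y) → Disjoint D X
disjoint-prefixʳ X disj (v∈D , v∈X) = disj (v∈D , ∈-++⁺ˡ v∈X)

disjoint-head-last : ∀ {d D} I {M} → Disjoint (d ∷ D) (I ++ M ∷ []) → d ≢ M
disjoint-head-last I disj refl = disj (here refl , ∈-++⁺ʳ I (here refl))

size-prefixʳ : ∀ (D X Y : List ℕ) → length D + length X ≤ length D + length (X ++ Y)
size-prefixʳ D X Y = +-monoʳ-≤ (length D) (subst (length X ≤_) (sym (length-++ X)) (m≤m+n _ _))

s-∷-max-∷ : ∀ {d M m D I ρ} → d < M → All (_< d) D → m < M → All (_< M) I →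
  s ρ ≡ D ++ m ∷ I → s (d ∷ M ∷ ρ) ≡ (d ∷ D) ++ m ∷ I ++ M ∷ []
s-∷-max-∷ {d} {M} {m} {D} {I} {ρ} d<M D<d m<M I<M sρ≡ = begin
  s (d ∷ M ∷ ρ)                    ≡⟨ s-++-∷ (d ∷ []) ρ (d<M ∷ []) ρ<M ⟩
  s (d ∷ []) ++ s ρ ++ M ∷ []      ≡⟨ cong₂ (λ x y → x ++ y ++ M ∷ []) (s-[x] d) sρ≡ ⟩
  d ∷ (D ++ m ∷ I) ++ M ∷ []       ≡⟨ cong (d ∷_) (++-assoc D (m ∷ I) (M ∷ [])) ⟩
  (d ∷ D) ++ m ∷ I ++ M ∷ []       ∎
  where
    open ≡-Reasoning
    ρ<M : All (_< M) ρ
    ρ<M = All-preimage sρ≡ (Allₚ.++⁺ (All.map (λ x<d → <-trans x<d d<M) D<d) (m<M ∷ I<M))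

max-∷≢∷ʳ-max : ∀ {M x W} ρ → All (_< M) ρ → s ρ ≡ x ∷ W → M ∷ ρ ≢ ρ ++ M ∷ []
max-∷≢∷ʳ-max [] _ () _
max-∷≢∷ʳ-max (r ∷ _) (r<M ∷ _) _ eq = <⇒≢ r<M (sym (proj₁ (∷-injective eq)))

PreimagesBelow : ℕ → Set
PreimagesBelow n = ∀ D m I → length D + length I < n → Valley D m I → Disjoint D I → Preimages D m I

module _ {n} (below : PreimagesBelow n) where

  ballot-below : ∀ {D m I} → length D + length I < n → Valley D m I → Disjoint D I →
    ∀ τ → s τ ≡ D ++ m ∷ I → Ballot D I
  ballot-below size< v disj = Preimages.ballot-necessary (below _ _ _ size< v disj)

  ballot-step : ∀ D m I M → length D + length I < n → Valley D m (I ++ M ∷ []) →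
    Disjoint D (I ++ M ∷ []) → ∀ τ → s τ ≡ D ++ m ∷ I ++ M ∷ [] → Ballot D (I ++ M ∷ [])
  ballot-step D m I M size< v disj τ sτ≡
    with valley-∷ʳ⁻ v | preimageShape D m I M τ (Valley.decreasing v) sτ≡
  ... | vI , _ | max-first R sR≡ =
    ballot-++ʳ D I (M ∷ []) (ballot-below size< vI (disjoint-prefixʳ I disj) R sR≡)
  ... | vI , _ | max-second d D′ R refl _ d≤M sR≡ =
    ballot-∷-∷ʳ⁺ D′ I (≤∧≢⇒< d≤M (disjoint-head-last I disj)) (AllPairs.head (Valley.decreasing v))
      (ballot-below (<-trans (n<1+n _) size<) (valley-tailˡ vI) (contractₗ (disjoint-prefixʳ I disj)) R sR≡)
  ... | vI , _ | max-after-min L R X refl sL≡ =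
    ballot-++ʳ D (X ++ s R) (M ∷ []) (ballot-++ʳ D X (s R)
      (ballot-below (≤-<-trans (size-prefixʳ D X (s R)) size<) (valley-prefixʳ X vI)
        (disjoint-prefixʳ X (disjoint-prefixʳ (X ++ s R) disj)) L sL≡))

  no-preimage-if-shorter : ∀ D m X → length D + length X < n → Valley D m X → Disjoint D X →
    length X < length D → ∀ τ → s τ ≢ D ++ m ∷ X
  no-preimage-if-shorter D m X size< v disj shorter τ sτ≡ =
    <⇒≱ shorter (ballot⇒length≤ (Valley.left>min v) (Valley.right>min v) (ballot-below size< v disj τ sτ≡))

  preimage-starts-head-max : ∀ d D m I M → length (d ∷ D) + length I < n →
    Valley (d ∷ D) m (I ++ M ∷ []) → Disjoint (d ∷ D) (I ++ M ∷ []) → length I < length (d ∷ D) →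
    ∀ τ → s τ ≡ (d ∷ D) ++ m ∷ I ++ M ∷ [] → ∃ λ R → τ ≡ d ∷ M ∷ R × s R ≡ D ++ m ∷ I
  preimage-starts-head-max d D m I M size< v disj shorter τ sτ≡
    with valley-∷ʳ⁻ v | preimageShape (d ∷ D) m I M τ (Valley.decreasing v) sτ≡
  ... | vI , _ | max-first R sR≡ =
    ⊥-elim (no-preimage-if-shorter (d ∷ D) m I size< vI (disjoint-prefixʳ I disj) shorter R sR≡)
  ... | _ | max-second _ _ R refl τ≡ _ sR≡ = R , τ≡ , sR≡
  ... | vI , _ | max-after-min L R X refl sL≡ =
    ⊥-elim (no-preimage-if-shorter (d ∷ D) m X (≤-<-trans (size-prefixʳ (d ∷ D) X (s R)) size<)
      (valley-prefixʳ X vI) (disjoint-prefixʳ X (disjoint-prefixʳ (X ++ s R) disj))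
      (≤-<-trans (subst (length X ≤_) (sym (length-++ X)) (m≤m+n _ _)) shorter) L sL≡)

  unique-step : ∀ D m I M → length D + length I < n → Valley D m (I ++ M ∷ []) →
    Disjoint D (I ++ M ∷ []) → Ballot D (I ++ M ∷ []) → length D ≡ length (I ++ M ∷ []) →
    UniquePreimage (D ++ m ∷ I ++ M ∷ [])
  unique-step [] m I M _ _ _ _ balanced = ⊥-elim (0≢1+n (trans balanced (length-∷ʳ I)))
  unique-step (d ∷ D) m I M size< v disj ballot balanced =
    let (vI , I<M , m<M) = valley-∷ʳ⁻ v
        D<d = AllPairs.head (Valley.decreasing v)
        d<M = ballot-head< D I I<M (disjoint-head-last I disj) ballot
        |D|≡|I| = suc-injective (trans balanced (length-∷ʳ I))
        IH = below D m I (<-trans (n<1+n _) size<) (valley-tailˡ vI) (contractₗ (disjoint-prefixʳ I disj))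
        (σ , sσ≡ , σ-unique) = Preimages.unique-if-balanced IH (ballot-∷-∷ʳ⁻ D I D<d ballot) |D|≡|I|
        I-shorter = subst (_< length (d ∷ D)) |D|≡|I| (n<1+n _)
    in d ∷ M ∷ σ , s-∷-max-∷ d<M D<d m<M I<M sσ≡ , λ τ sτ≡ →
         let (R , τ≡ , sR≡) = preimage-starts-head-max d D m I M size< v disj I-shorter τ sτ≡
         in trans τ≡ (cong (λ ρ → d ∷ M ∷ ρ) (σ-unique R sR≡))

  two-step : ∀ D m I M → length D + length I < n → Valley D m (I ++ M ∷ []) →
    Disjoint D (I ++ M ∷ []) → Ballot D (I ++ M ∷ []) → length D < length (I ++ M ∷ []) →
    TwoPreimages (D ++ m ∷ I ++ M ∷ [])
  two-step [] m I M size< v disj _ _ =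
    let (vI , I<M , m<M) = valley-∷ʳ⁻ v
        (ρ , sρ≡) = preimage-exists vI (below [] m I size< vI (disjoint-prefixʳ I disj)) (ballot-[]ˡ I)
        ρ<M = All-preimage sρ≡ (m<M ∷ I<M)
    in M ∷ ρ , ρ ++ M ∷ [] ,
       trans (s-++-∷ [] ρ [] ρ<M) (cong (_++ M ∷ []) sρ≡) ,
       trans (s-++-∷ ρ [] ρ<M []) (cong (_++ M ∷ []) sρ≡) ,
       max-∷≢∷ʳ-max ρ ρ<M sρ≡
  two-step (d ∷ D) m I M size< v disj ballot shorter =
    let (vI , I<M , m<M) = valley-∷ʳ⁻ v
        D<d = AllPairs.head (Valley.decreasing v)
        d<M = ballot-head< D I I<M (disjoint-head-last I disj) ballot
        D-shorter = s<s⁻¹ (subst (length (d ∷ D) <_) (length-∷ʳ I) shorter)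
        IH = below D m I (<-trans (n<1+n _) size<) (valley-tailˡ vI) (contractₗ (disjoint-prefixʳ I disj))
        (ρ₁ , ρ₂ , sρ₁≡ , sρ₂≡ , ρ₁≢ρ₂) =
          Preimages.two-if-unbalanced IH (ballot-∷-∷ʳ⁻ D I D<d ballot) D-shorter
    in d ∷ M ∷ ρ₁ , d ∷ M ∷ ρ₂ ,
       s-∷-max-∷ d<M D<d m<M I<M sρ₁≡ , s-∷-max-∷ d<M D<d m<M I<M sρ₂≡ ,
       λ eq → ρ₁≢ρ₂ (∷-injectiveʳ (∷-injectiveʳ eq))

ballot-[]ʳ : ∀ D m → All (m <_) D → ∀ τ → s τ ≡ D ++ m ∷ [] → Ballot D []
ballot-[]ʳ [] m _ _ _ = ballot-[]ˡ []
ballot-[]ʳ (d ∷ D) m (m<d ∷ _) τ sτ≡ = ⊥-elim (<⇒≱ m<d (All.head (s≡∷ʳ⇒upper τ (d ∷ D) m sτ≡)))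

unique-[]ʳ : ∀ D m → length D ≡ 0 → UniquePreimage (D ++ m ∷ [])
unique-[]ʳ [] m _ = m ∷ [] , s-[x] m , λ τ → s≡[x]⇒≡[x]

preimages : ∀ n → PreimagesBelow n
preimages (suc n) D m I size< v disj with initLast I
... | [] = record
  { ballot-necessary   = ballot-[]ʳ D m (Valley.left>min v)
  ; unique-if-balanced = λ _ → unique-[]ʳ D m
  ; two-if-unbalanced  = λ _ ()
  }
... | I′ ∷ʳ′ M = record
  { ballot-necessary   = ballot-step (preimages n) D m I′ M size′ v disj
  ; unique-if-balanced = unique-step (preimages n) D m I′ M size′ v disj
  ; two-if-unbalanced  = two-step (preimages n) D m I′ M size′ v disj
  }
  where
    size′ : length D + length I′ < n
    size′ = s<s⁻¹ (subst (_< suc n)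
      (trans (cong (length D +_) (length-∷ʳ I′)) (+-suc (length D) (length I′))) size<)

-- Valleys as Dyck words

-- In a word y, the letter followed by ℓ further letters carries the value ℓ + 2: a true sends it
-- to the decreasing side of the valley, a false to the increasing side.  The minimum is 1.
decreasingPart : List Bool → List ℕ
decreasingPart [] = []
decreasingPart (true ∷ y) = suc (suc (length y)) ∷ decreasingPart y
decreasingPart (false ∷ y) = decreasingPart y

increasingPart : List Bool → List ℕ
increasingPart [] = []
increasingPart (true ∷ y) = increasingPart y
increasingPart (false ∷ y) = increasingPart y ++ suc (suc (length y)) ∷ []

valleyOf : List Bool → List ℕ
valleyOf y = decreasingPart y ++ 1 ∷ increasingPart y

decreasingPart-≤ : ∀ y → All (_≤ suc (length y)) (decreasingPart y)
decreasingPart-≤ [] = []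
decreasingPart-≤ (true ∷ y) = ≤-refl ∷ All.map m≤n⇒m≤1+n (decreasingPart-≤ y)
decreasingPart-≤ (false ∷ y) = All.map m≤n⇒m≤1+n (decreasingPart-≤ y)

increasingPart-≤ : ∀ y → All (_≤ suc (length y)) (increasingPart y)
increasingPart-≤ [] = []
increasingPart-≤ (true ∷ y) = All.map m≤n⇒m≤1+n (increasingPart-≤ y)
increasingPart-≤ (false ∷ y) = Allₚ.∷ʳ⁺ (All.map m≤n⇒m≤1+n (increasingPart-≤ y)) ≤-refl

valley-valleyOf : ∀ y → Valley (decreasingPart y) 1 (increasingPart y)
valley-valleyOf [] = valley [] [] [] []
valley-valleyOf (true ∷ y) with valley-valleyOf y
... | valley dec inc 1<D 1<I = valley (All.map s≤s (decreasingPart-≤ y) ∷ dec) inc (s≤s z<s ∷ 1<D) 1<I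
valley-valleyOf (false ∷ y) with valley-valleyOf y
... | valley dec inc 1<D 1<I =
  valley dec (AllPairsₚ.++⁺ inc ([] ∷ []) (All.map (λ x≤ → s≤s x≤ ∷ []) (increasingPart-≤ y)))
    1<D (Allₚ.∷ʳ⁺ 1<I (s≤s z<s))

disjoint-valleyOf : ∀ y → Disjoint (decreasingPart y) (increasingPart y)
disjoint-valleyOf [] (() , _)
disjoint-valleyOf (true ∷ y) (here refl , v∈I) = 1+n≰n (All.lookup (increasingPart-≤ y) v∈I)
disjoint-valleyOf (true ∷ y) (there v∈D , v∈I) = disjoint-valleyOf y (v∈D , v∈I)
disjoint-valleyOf (false ∷ y) (v∈D , v∈I) with ∈-++⁻ (increasingPart y) v∈I
... | inj₁ v∈I′ = disjoint-valleyOf y (v∈D , v∈I′)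
... | inj₂ (here refl) = 1+n≰n (All.lookup (decreasingPart-≤ y) v∈D)

range-∷ʳ : ∀ n → range (suc n) ≡ range n ++ suc n ∷ []
range-∷ʳ n = trans (cong (map suc) (sym (upTo-∷ʳ n))) (map-++ suc (upTo n) (n ∷ []))

length-range : ∀ n → length (range n) ≡ n
length-range n = trans (length-map suc (upTo n)) (length-upTo n)

range-≤ : ∀ n → All (_≤ n) (range n)
range-≤ n = Allₚ.map⁺ (All.tabulate ∈-upTo⁻)

max∈range : ∀ n → suc n ∈ range (suc n)
max∈range n = ∈-map⁺ suc (∈-upTo⁺ (n<1+n n))

valleyOf-↭ : ∀ y → valleyOf y ↭ range (suc (length y))
valleyOf-↭ [] = ↭-refl
valleyOf-↭ (true ∷ y) = begin
  suc (suc (length y)) ∷ valleyOf y   ↭⟨ ∷↭∷ʳ _ (valleyOf y) ⟩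
  valleyOf y ++ _ ∷ []                ↭⟨ ++⁺ʳ _ (valleyOf-↭ y) ⟩
  range (suc (length y)) ++ _ ∷ []    ≡⟨ range-∷ʳ (suc (length y)) ⟨
  range (suc (suc (length y)))        ∎
  where open PermutationReasoning
valleyOf-↭ (false ∷ y) = begin
  decreasingPart y ++ 1 ∷ increasingPart y ++ _ ∷ []  ≡⟨ ++-assoc (decreasingPart y) (1 ∷ increasingPart y) _ ⟨
  valleyOf y ++ _ ∷ []                                ↭⟨ ++⁺ʳ _ (valleyOf-↭ y) ⟩
  range (suc (length y)) ++ _ ∷ []                    ≡⟨ range-∷ʳ (suc (length y)) ⟨
  range (suc (suc (length y)))                        ∎
  where open PermutationReasoning

length-valleyOf : ∀ y → length (valleyOf y) ≡ suc (length y)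
length-valleyOf y = trans (↭-length (valleyOf-↭ y)) (length-range (suc (length y)))

DyckFrom : ℕ → List Bool → Set
DyckFrom h [] = h ≡ 0
DyckFrom h (false ∷ y) = DyckFrom (suc h) y
DyckFrom zero (true ∷ y) = ⊥
DyckFrom (suc h) (true ∷ y) = DyckFrom h y

dyck⇒ballotBy : ∀ h y → DyckFrom h y → BallotBy h (decreasingPart y) (increasingPart y)
dyck⇒ballotBy h [] _ u = z≤n
dyck⇒ballotBy h (false ∷ y) dyck =
  ballotBy-∷ʳ⁺ (decreasingPart y) (increasingPart y) (All.map s≤s (decreasingPart-≤ y))
    (dyck⇒ballotBy (suc h) y dyck)
dyck⇒ballotBy (suc h) (true ∷ y) dyck =
  ballotBy-∷⁺ (decreasingPart y) (increasingPart y) (All.map s≤s (decreasingPart-≤ y)) (dyck⇒ballotBy h y dyck)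

dyck⇒length : ∀ h y → DyckFrom h y → length (decreasingPart y) ≡ length (increasingPart y) + h
dyck⇒length h [] refl = refl
dyck⇒length h (false ∷ y) dyck = begin
  length (decreasingPart y)                               ≡⟨ dyck⇒length (suc h) y dyck ⟩
  length (increasingPart y) + suc h                       ≡⟨ +-suc _ h ⟩
  suc (length (increasingPart y)) + h                     ≡⟨ cong (_+ h) (length-∷ʳ (increasingPart y)) ⟨
  length (increasingPart y ++ suc (suc (length y)) ∷ []) + h  ∎
  where open ≡-Reasoning
dyck⇒length (suc h) (true ∷ y) dyck = trans (cong suc (dyck⇒length h y dyck)) (sym (+-suc _ h))

ballotBy⇒dyck : ∀ h y → BallotBy h (decreasingPart y) (increasingPart y) →
  length (decreasingPart y) ≡ length (increasingPart y) + h → DyckFrom h y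
ballotBy⇒dyck h [] _ |D|≡ = sym |D|≡
ballotBy⇒dyck h (false ∷ y) ballot |D|≡ =
  ballotBy⇒dyck (suc h) y (ballotBy-∷ʳ⁻ (decreasingPart y) (increasingPart y) ballot)
    (trans |D|≡ (trans (cong (_+ h) (length-∷ʳ (increasingPart y))) (sym (+-suc _ h))))
ballotBy⇒dyck zero (true ∷ y) ballot _ =
  ¬ballotBy-0-∷ (decreasingPart y) (increasingPart y) (increasingPart-≤ y) ballot
ballotBy⇒dyck (suc h) (true ∷ y) ballot |D|≡ =
  ballotBy⇒dyck h y (ballotBy-∷⁻ (decreasingPart y) (increasingPart y) (All.map s≤s (decreasingPart-≤ y)) ballot)
    (suc-injective (trans |D|≡ (+-suc _ h)))

decreasing-max : ∀ {t x xs} → AllPairs _>_ (x ∷ xs) → t ∈ x ∷ xs → x ≤ t → t ≡ x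
decreasing-max _ (here t≡x) _ = t≡x
decreasing-max (xs<x ∷ _) (there t∈xs) x≤t = ⊥-elim (<⇒≱ (All.lookup xs<x t∈xs) x≤t)

increasing-max : ∀ {t} xs → AllPairs _<_ xs → t ∈ xs → All (_≤ t) xs →
  ∃ λ xs′ → xs ≡ xs′ ++ t ∷ []
increasing-max xs inc t∈ ≤t with initLast xs
increasing-max .[] _ () _ | []
... | xs′ ∷ʳ′ M with ∈-++⁻ xs′ t∈
...   | inj₁ t∈xs′ =
  ⊥-elim (<⇒≱ (All.lookup (AllPairs-∷ʳ⁻ xs′ inc) t∈xs′) (proj₂ (Allₚ.∷ʳ⁻ ≤t)))
...   | inj₂ (here refl) = xs′ , refl

data ValleyTop (t : ℕ) : List ℕ → ℕ → List ℕ → Set where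
  top-left  : ∀ {D m I} → ValleyTop t (t ∷ D) m I
  top-right : ∀ {D m I} → ValleyTop t D m (I ++ t ∷ [])
  top-only  : ValleyTop t [] t []

valley-top : ∀ {t D m I} → Valley D m I → t ∈ D ++ m ∷ I → All (_≤ t) (D ++ m ∷ I) → ValleyTop t D m I
valley-top {D = D} _ t∈ ≤t with ∈-++⁻ D t∈ | Allₚ.++⁻ D ≤t
valley-top {D = d ∷ D} (valley dec _ _ _) _ _ | inj₁ t∈D | d≤t ∷ _ , _ with decreasing-max dec t∈D d≤t
... | refl = top-left
valley-top {D = d ∷ _} (valley _ _ (m<d ∷ _) _) _ _ | inj₂ (here refl) | d≤m ∷ _ , _ =
  ⊥-elim (<⇒≱ m<d d≤m)
valley-top {D = []} {I = i ∷ _} (valley _ _ _ (m<i ∷ _)) _ _ | inj₂ (here refl) | _ , _ ∷ i≤m ∷ _ =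
  ⊥-elim (<⇒≱ m<i i≤m)
valley-top {D = []} {I = []} _ _ _ | inj₂ (here refl) | _ = top-only
valley-top {I = I} (valley _ inc _ _) _ _ | inj₂ (there t∈I) | _ , _ ∷ I≤t with increasing-max I inc t∈I I≤t
... | I′ , refl = top-right

Encodes : ℕ → List ℕ → ℕ → List ℕ → Set
Encodes n D m I = ∃ λ y → length y ≡ n × D ≡ decreasingPart y × m ≡ 1 × I ≡ increasingPart y

↭-range-∷ʳ⁻ : ∀ {n} xs → xs ++ suc n ∷ [] ↭ range (suc n) → xs ↭ range n
↭-range-∷ʳ⁻ {n} xs p =
  subst₂ _↭_ (++-identityʳ xs) (++-identityʳ (range n)) (drop-mid xs (range n) (↭-trans p (↭-reflexive (range-∷ʳ n))))

decode : ∀ n {D m I} → Valley D m I → D ++ m ∷ I ↭ range (suc n) → Encodes n D m I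
decode zero {[]} {I = []} _ p with ↭-singleton-inv p
... | refl = [] , refl , refl , refl , refl
decode zero {[]} {I = _ ∷ _} _ p with ↭-length p
... | ()
decode zero {_ ∷ D} {m} {I} _ p with ++-conicalʳ D (m ∷ I) (∷-injectiveʳ (↭-singleton-inv p))
... | ()
decode (suc n) {D} {m} {I} v p
  with valley-top v (∈-resp-↭ (↭-sym p) (max∈range (suc n))) (All-resp-↭ (↭-sym p) (range-≤ (suc (suc n))))
... | top-left {D′} =
  let (y , |y| , D′≡ , m≡ , I≡) =
        decode n (valley-tailˡ v) (↭-range-∷ʳ⁻ (D′ ++ m ∷ I) (↭-trans (↭-sym (∷↭∷ʳ _ _)) p))
  in true ∷ y , cong suc |y| , cong₂ _∷_ (cong (λ k → suc (suc k)) (sym |y|)) D′≡ , m≡ , I≡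
... | top-right {I = I′} =
  let (y , |y| , D≡ , m≡ , I′≡) =
        decode n (proj₁ (valley-∷ʳ⁻ v)) (↭-range-∷ʳ⁻ (D ++ m ∷ I′) (↭-trans (↭-reflexive (++-assoc D (m ∷ I′) _)) p))
  in false ∷ y , cong suc |y| , D≡ , m≡ , cong₂ _++_ I′≡ (cong (λ k → suc (suc k) ∷ []) (sym |y|))
... | top-only = ⊥-elim (0≢1+n (suc-injective (trans (↭-length p) (length-range (suc (suc n))))))

parts-injective : ∀ y₁ y₂ → length y₁ ≡ length y₂ → decreasingPart y₁ ≡ decreasingPart y₂ →
  increasingPart y₁ ≡ increasingPart y₂ → y₁ ≡ y₂
parts-injective [] [] _ _ _ = refl
parts-injective (true ∷ y₁) (true ∷ y₂) |y| D≡ I≡ =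
  cong (true ∷_) (parts-injective y₁ y₂ (suc-injective |y|) (∷-injectiveʳ D≡) I≡)
parts-injective (false ∷ y₁) (false ∷ y₂) |y| D≡ I≡ =
  cong (false ∷_) (parts-injective y₁ y₂ (suc-injective |y|) D≡ (∷ʳ-injectiveˡ (increasingPart y₁) _ I≡))
parts-injective (true ∷ y₁) (false ∷ y₂) |y| D≡ _ = ⊥-elim (1+n≰n
  (subst (λ k → suc (suc k) ≤ suc (length y₂)) (suc-injective |y|)
    (All.head (subst (All (_≤ suc (length y₂))) (sym D≡) (decreasingPart-≤ y₂)))))
parts-injective (false ∷ y₁) (true ∷ y₂) |y| D≡ _ = ⊥-elim (1+n≰n
  (subst (λ k → suc (suc k) ≤ suc (length y₁)) (sym (suc-injective |y|))
    (All.head (subst (All (_≤ suc (length y₁))) D≡ (decreasingPart-≤ y₁)))))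

valleyOf-injective : ∀ {y₁ y₂} → valleyOf y₁ ≡ valleyOf y₂ → y₁ ≡ y₂
valleyOf-injective {y₁} {y₂} eq =
  let (D≡ , I≡) = ++-∷-first-injective _ _ _ _ (≢1 y₁) (≢1 y₂) eq
  in parts-injective y₁ y₂ |y₁|≡|y₂| D≡ I≡
  where
    ≢1 : ∀ y → All (_≢ 1) (decreasingPart y)
    ≢1 y = All.map (λ 1<x x≡1 → <⇒≢ 1<x (sym x≡1)) (Valley.left>min (valley-valleyOf y))
    |y₁|≡|y₂| : length y₁ ≡ length y₂
    |y₁|≡|y₂| = suc-injective (trans (sym (length-valleyOf y₁)) (trans (cong length eq) (length-valleyOf y₂)))

-- Counting Dyck words

dyckWords : ℕ → ℕ → List (List Bool)
dyckWords zero zero = [] ∷ []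
dyckWords zero (suc h) = map (true ∷_) (dyckWords zero h)
dyckWords (suc j) zero = map (false ∷_) (dyckWords j 1)
dyckWords (suc j) (suc h) = map (false ∷_) (dyckWords j (suc (suc h))) ++ map (true ∷_) (dyckWords (suc j) h)

∈-dyckWords⁻ : ∀ j h y → y ∈ dyckWords j h → DyckFrom h y × length y ≡ h + (j + j)
∈-dyckWords⁻ zero zero .[] (here refl) = refl , refl
∈-dyckWords⁻ zero (suc h) y y∈ with ∈-map⁻ (true ∷_) y∈
... | y′ , y′∈ , refl = let (dyck , |y′|) = ∈-dyckWords⁻ zero h y′ y′∈ in dyck , cong suc |y′|
∈-dyckWords⁻ (suc j) zero y y∈ with ∈-map⁻ (false ∷_) y∈
... | y′ , y′∈ , refl =
  let (dyck , |y′|) = ∈-dyckWords⁻ j 1 y′ y′∈ in dyck , cong suc (trans |y′| (sym (+-suc j j)))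
∈-dyckWords⁻ (suc j) (suc h) y y∈ with ∈-++⁻ (map (false ∷_) (dyckWords j (suc (suc h)))) y∈
... | inj₁ y∈up with ∈-map⁻ (false ∷_) y∈up
...   | y′ , y′∈ , refl =
  let (dyck , |y′|) = ∈-dyckWords⁻ j (suc (suc h)) y′ y′∈ in dyck , trans (cong suc |y′|) (length-up h j)
  where
    length-up : ∀ h j → suc (suc (suc h) + (j + j)) ≡ suc h + (suc j + suc j)
    length-up = solve-∀
∈-dyckWords⁻ (suc j) (suc h) y y∈ | inj₂ y∈down with ∈-map⁻ (true ∷_) y∈down
...   | y′ , y′∈ , refl = let (dyck , |y′|) = ∈-dyckWords⁻ (suc j) h y′ y′∈ in dyck , cong suc |y′|

dyck⇒height≤length : ∀ h y → DyckFrom h y → h ≤ length y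
dyck⇒height≤length h [] refl = z≤n
dyck⇒height≤length h (false ∷ y) dyck = m≤n⇒m≤1+n (<⇒≤ (dyck⇒height≤length (suc h) y dyck))
dyck⇒height≤length (suc h) (true ∷ y) dyck = s≤s (dyck⇒height≤length h y dyck)

∈-dyckWords⁺ : ∀ j h y → DyckFrom h y → length y ≡ h + (j + j) → y ∈ dyckWords j h
∈-dyckWords⁺ zero .0 [] refl _ = here refl
∈-dyckWords⁺ zero h (false ∷ y) dyck |y| =
  ⊥-elim (1+n≰n (≤-trans (dyck⇒height≤length (suc h) y dyck)
                         (≤-trans (n≤1+n _) (≤-reflexive (trans |y| (+-identityʳ h))))))
∈-dyckWords⁺ (suc j) zero (false ∷ y) dyck |y| =
  ∈-map⁺ (false ∷_) (∈-dyckWords⁺ j 1 y dyck (suc-injective (trans |y| (cong suc (+-suc j j)))))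
∈-dyckWords⁺ (suc j) (suc h) (false ∷ y) dyck |y| =
  ∈-++⁺ˡ (∈-map⁺ (false ∷_) (∈-dyckWords⁺ j (suc (suc h)) y dyck (suc-injective (trans |y| (length-up h j)))))
  where
    length-up : ∀ h j → suc h + (suc j + suc j) ≡ suc (suc (suc h) + (j + j))
    length-up = solve-∀
∈-dyckWords⁺ zero (suc h) (true ∷ y) dyck |y| =
  ∈-map⁺ (true ∷_) (∈-dyckWords⁺ zero h y dyck (suc-injective |y|))
∈-dyckWords⁺ (suc j) (suc h) (true ∷ y) dyck |y| =
  ∈-++⁺ʳ (map (false ∷_) (dyckWords j (suc (suc h))))
    (∈-map⁺ (true ∷_) (∈-dyckWords⁺ (suc j) h y dyck (suc-injective |y|)))

dyckWords-unique : ∀ j h → Unique (dyckWords j h)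
dyckWords-unique zero zero = [] ∷ []
dyckWords-unique zero (suc h) = Uniqueₚ.map⁺ ∷-injectiveʳ (dyckWords-unique zero h)
dyckWords-unique (suc j) zero = Uniqueₚ.map⁺ ∷-injectiveʳ (dyckWords-unique j 1)
dyckWords-unique (suc j) (suc h) =
  Uniqueₚ.++⁺ (Uniqueₚ.map⁺ ∷-injectiveʳ (dyckWords-unique j (suc (suc h))))
              (Uniqueₚ.map⁺ ∷-injectiveʳ (dyckWords-unique (suc j) h)) first-letters-differ
  where
    first-letters-differ : ∀ {y} →
      ¬ (y ∈ map (false ∷_) (dyckWords j (suc (suc h))) × y ∈ map (true ∷_) (dyckWords (suc j) h))
    first-letters-differ (y∈up , y∈down) with ∈-map⁻ (false ∷_) y∈up | ∈-map⁻ (true ∷_) y∈down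
    ... | _ , _ , refl | _ , _ , ()

-- r C (j ∸ 1), except that it is 0 rather than 1 at j = 0
C-pred : ℕ → ℕ → ℕ
C-pred r zero = 0
C-pred r (suc j) = r C j

pascal : ∀ r j → suc r C j ≡ C-pred r j + r C j
pascal r zero = refl
pascal r (suc j) = sym (nCk+nC[k+1]≡[n+1]C[k+1] r j)

[1+k]Ck≡1+k : ∀ k → suc k C k ≡ suc k
[1+k]Ck≡1+k k = begin
  suc k C k          ≡⟨ nCk≡nC[n∸k] (n≤1+n k) ⟩
  suc k C (suc k ∸ k) ≡⟨ cong (suc k C_) (m+n∸n≡m 1 k) ⟩
  suc k C 1          ≡⟨ nC1≡n (suc k) ⟩
  suc k              ∎
  where open ≡-Reasoning

C-middle : ∀ j → suc (j + j) C j ≡ suc (j + j) C suc j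
C-middle j = trans (nCk≡nC[n∸k] (≤-trans (m≤m+n j j) (n≤1+n _))) (cong (suc (j + j) C_) (m+n∸n≡m (suc j) j))

C-ratio : ∀ k r → ((k + suc r) C k) * suc r ≡ ((k + suc r) C suc k) * suc k
C-ratio zero r = trans (*-identityˡ (suc r)) (sym (trans (*-identityʳ _) (nC1≡n (suc r))))
C-ratio (suc k) zero = subst (λ n → (suc n C suc k) * 1 ≡ (suc n C suc (suc k)) * suc (suc k)) (sym k+1≡1+k) (begin
  (suc (suc k) C suc k) * 1             ≡⟨ *-identityʳ _ ⟩
  suc (suc k) C suc k                   ≡⟨ [1+k]Ck≡1+k (suc k) ⟩
  suc (suc k)                           ≡⟨ *-identityˡ (suc (suc k)) ⟨
  1 * suc (suc k)                       ≡⟨ cong (_* suc (suc k)) (nCn≡1 (suc (suc k))) ⟨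
  (suc (suc k) C suc (suc k)) * suc (suc k) ∎)
  where
    open ≡-Reasoning
    k+1≡1+k : k + 1 ≡ suc k
    k+1≡1+k = +-comm k 1
C-ratio (suc k) (suc r) = begin
  (suc P C suc k) * (2 + r)       ≡⟨ cong (_* (2 + r)) (nCk+nC[k+1]≡[n+1]C[k+1] P k) ⟨
  (a + b) * (2 + r)               ≡⟨ *-distribʳ-+ (2 + r) a b ⟩
  a * (2 + r) + b * (2 + r)       ≡⟨ cong (_+ b * (2 + r)) (C-ratio k (suc r)) ⟩
  b * (1 + k) + b * (2 + r)       ≡⟨ regroup b k r ⟩
  b * (2 + k) + b * (1 + r)       ≡⟨ cong (b * (2 + k) +_) ratio ⟩
  b * (2 + k) + c * (2 + k)       ≡⟨ *-distribʳ-+ (2 + k) b c ⟨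
  (b + c) * (2 + k)               ≡⟨ cong (_* (2 + k)) (nCk+nC[k+1]≡[n+1]C[k+1] P (suc k)) ⟩
  (suc P C suc (suc k)) * (2 + k) ∎
  where
    open ≡-Reasoning
    P = k + suc (suc r)
    a = P C k
    b = P C suc k
    c = P C suc (suc k)
    regroup : ∀ b k r → b * (1 + k) + b * (2 + r) ≡ b * (2 + k) + b * (1 + r)
    regroup = solve-∀
    ratio : b * (1 + r) ≡ c * (2 + k)
    ratio = subst (λ n → (n C suc k) * suc r ≡ (n C suc (suc k)) * suc (suc k))
              (sym (+-suc k (suc r))) (C-ratio (suc k) r)

length-dyckWords : ∀ j h → length (dyckWords j h) + C-pred (h + (j + j)) j ≡ (h + (j + j)) C j
length-dyckWords zero zero = refl
length-dyckWords zero (suc h) =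
  trans (cong (_+ 0) (length-map (true ∷_) (dyckWords zero h))) (length-dyckWords zero h)
length-dyckWords (suc j) zero =
  subst (λ n → length (dyckWords (suc j) 0) + C-pred n (suc j) ≡ n C suc j) (cong suc (sym (+-suc j j))) (begin
    length (dyckWords (suc j) 0) + suc r C j      ≡⟨ cong₂ _+_ (length-map (false ∷_) (dyckWords j 1)) (pascal r j) ⟩
    length (dyckWords j 1) + (C-pred r j + r C j) ≡⟨ +-assoc (length (dyckWords j 1)) _ _ ⟨
    length (dyckWords j 1) + C-pred r j + r C j   ≡⟨ cong (_+ r C j) (length-dyckWords j 1) ⟩
    r C j + r C j                                 ≡⟨ cong (r C j +_) (C-middle j) ⟩
    r C j + r C suc j                             ≡⟨ nCk+nC[k+1]≡[n+1]C[k+1] r j ⟩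
    suc r C suc j                                 ∎)
  where
    open ≡-Reasoning
    r = suc (j + j)
length-dyckWords (suc j) (suc h) = begin
  length (dyckWords (suc j) (suc h)) + suc r C j        ≡⟨ cong₂ _+_ length-split (pascal r j) ⟩
  (length up + length down) + (C-pred r j + r C j)      ≡⟨ regroup (length up) (length down) (C-pred r j) (r C j) ⟩
  (length up + C-pred r j) + (length down + r C j)      ≡⟨ cong₂ _+_ count-up (length-dyckWords (suc j) h) ⟩
  r C j + r C suc j                                     ≡⟨ nCk+nC[k+1]≡[n+1]C[k+1] r j ⟩
  suc r C suc j                                         ∎
  where
    open ≡-Reasoning
    r = h + (suc j + suc j)
    up = dyckWords j (suc (suc h))
    down = dyckWords (suc j) h
    length-split : length (dyckWords (suc j) (suc h)) ≡ length up + length down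
    length-split = trans (length-++ (map (false ∷_) up))
                     (cong₂ _+_ (length-map (false ∷_) up) (length-map (true ∷_) down))
    regroup : ∀ a b c d → (a + b) + (c + d) ≡ (a + c) + (b + d)
    regroup = solve-∀
    count-up : length up + C-pred r j ≡ r C j
    count-up = subst (λ n → length up + C-pred n j ≡ n C j) (size h j) (length-dyckWords j (suc (suc h)))
      where
        size : ∀ h j → suc (suc h) + (j + j) ≡ h + (suc j + suc j)
        size = solve-∀

C-pred-ratio : ∀ k → C-pred (k + k) k * suc k ≡ ((k + k) C k) * k
C-pred-ratio zero = refl
C-pred-ratio (suc i) =
  subst (λ n → (n C i) * suc (suc i) ≡ (n C suc i) * suc i) (+-suc i (suc i)) (C-ratio i (suc i))

length-dyckWords-catalan : ∀ k → length (dyckWords k 0) ≡ catalan k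
length-dyckWords-catalan k = begin
  N                     ≡⟨ m*n/n≡m N (suc k) ⟨
  (N * suc k) / suc k   ≡⟨ cong (_/ suc k) (cancel N (C-pred (k + k) k) ((k + k) C k)
                                                 (length-dyckWords k 0) (C-pred-ratio k)) ⟩
  ((k + k) C k) / suc k ≡⟨ cong (λ n → ((k + n) C k) / suc k) (+-identityʳ k) ⟨
  catalan k             ∎
  where
    open ≡-Reasoning
    N = length (dyckWords k 0)
    cancel : ∀ a b c → a + b ≡ c → b * suc k ≡ c * k → a * suc k ≡ c
    cancel a b c a+b≡c ratio = +-cancelʳ-≡ (b * suc k) (a * suc k) c (begin
      a * suc k + b * suc k   ≡⟨ *-distribʳ-+ (suc k) a b ⟨
      (a + b) * suc k         ≡⟨ cong (_* suc k) a+b≡c ⟩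
      c * suc k               ≡⟨ *-suc c k ⟩
      c + c * k               ≡⟨ cong (c +_) ratio ⟨
      c + b * suc k           ∎)

-- Pattern avoidance

-- A peak with equal ends is an instance of neither 132 nor 231, hence the conclusion a ≡ c.
PeakFree : List ℕ → Set
PeakFree π = ∀ {a b c} → a ∷ b ∷ c ∷ [] ⊆ π → a < b → c < b → a ≡ c

both : ∀ {P Q : Set} → P → Q → P ⇔ Q
both p q = mk⇔ (λ _ → q) (λ _ → p)

neither : ∀ {P Q : Set} → ¬ P → ¬ Q → P ⇔ Q
neither ¬p ¬q = mk⇔ (λ p → ⊥-elim (¬p p)) (λ q → ⊥-elim (¬q q))

orderIso-triple : ∀ {a b c x y z} →
  (a < b ⇔ x < y) → (b < a ⇔ y < x) → (a < c ⇔ x < z) → (c < a ⇔ z < x) →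
  (b < c ⇔ y < z) → (c < b ⇔ z < y) →
  OrderIso (a ∷ b ∷ c ∷ []) (x ∷ y ∷ z ∷ [])
orderIso-triple {a} {b} {c} {x} {y} {z} ab ba ac ca bc cb = refl , table
  where
    irreflexive : ∀ {u v} → u < u ⇔ v < v
    irreflexive = neither (<-irrefl refl) (<-irrefl refl)
    table : (i j : Fin 3) → _
    table zero zero = irreflexive
    table zero (suc zero) = ab
    table zero (suc (suc zero)) = ac
    table (suc zero) zero = ba
    table (suc zero) (suc zero) = irreflexive
    table (suc zero) (suc (suc zero)) = bc
    table (suc (suc zero)) zero = ca
    table (suc (suc zero)) (suc zero) = cb
    table (suc (suc zero)) (suc (suc zero)) = irreflexive

peak-orderIso : ∀ {a b c x y z} → a < b → c < b → x < y → z < y →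
  (a < c ⇔ x < z) → (c < a ⇔ z < x) → OrderIso (a ∷ b ∷ c ∷ []) (x ∷ y ∷ z ∷ [])
peak-orderIso a<b c<b x<y z<y ac ca =
  orderIso-triple (both a<b x<y) (neither (<-asym a<b) (<-asym x<y)) ac ca
    (neither (<-asym c<b) (<-asym z<y)) (both c<b z<y)

orderIso-peak : ∀ σ {x y z} → x < y → z < y → OrderIso σ (x ∷ y ∷ z ∷ []) →
  ∃ λ a → ∃₂ λ b c → σ ≡ a ∷ b ∷ c ∷ [] × a < b × c < b × (x < z → a < c) × (z < x → c < a)
orderIso-peak (a ∷ b ∷ c ∷ []) x<y z<y (refl , iso) =
  a , b , c , refl , Equivalence.from (iso zero (suc zero)) x<y , Equivalence.from (iso (suc (suc zero)) (suc zero)) z<y ,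
  Equivalence.from (iso zero (suc (suc zero))) , Equivalence.from (iso (suc (suc zero)) zero)

1<2 : 1 < 2
1<2 = s≤s (s≤s z≤n)

1<3 : 1 < 3
1<3 = s≤s (s≤s z≤n)

2<3 : 2 < 3
2<3 = s≤s (s≤s (s≤s z≤n))

avoids-132-231⇒peakFree : ∀ π → Avoids π p132 → Avoids π p231 → PeakFree π
avoids-132-231⇒peakFree π avoid132 avoid231 {a} {b} {c} abc⊆π a<b c<b with <-cmp a c
... | tri< a<c _ _ = ⊥-elim (avoid132 (_ , abc⊆π ,
        peak-orderIso a<b c<b 1<3 2<3 (both a<c 1<2) (neither (<-asym a<c) (<-asym 1<2))))
... | tri≈ _ a≡c _ = a≡c
... | tri> _ _ c<a = ⊥-elim (avoid231 (_ , abc⊆π ,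
        peak-orderIso a<b c<b 2<3 1<3 (neither (<-asym c<a) (<-asym 1<2)) (both c<a 1<2)))

peakFree⇒avoids : ∀ {π x y z} → PeakFree π → x < y → z < y → x ≢ z → Avoids π (x ∷ y ∷ z ∷ [])
peakFree⇒avoids {x = x} {z = z} peakFree x<y z<y x≢z (σ , σ⊆π , iso)
  with orderIso-peak σ x<y z<y iso | <-cmp x z
... | a , b , c , refl , a<b , c<b , a<c , _ | tri< x<z _ _ = <-irrefl (peakFree σ⊆π a<b c<b) (a<c x<z)
... | _ | tri≈ _ x≡z _ = x≢z x≡z
... | a , b , c , refl , a<b , c<b , _ , c<a | tri> _ _ z<x = <-irrefl (sym (peakFree σ⊆π a<b c<b)) (c<a z<x)

increasing-⊆ : ∀ {b c I} → AllPairs _<_ I → b ∷ c ∷ [] ⊆ I → b < c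
increasing-⊆ (_ ∷ inc) (_ ∷ʳ bc⊆) = increasing-⊆ inc bc⊆
increasing-⊆ (b< ∷ _) (refl ∷ c⊆) = All.lookup b< (toAny c⊆)

valley-⊆-above : ∀ {b c m} D I → All (_< b) D → m < b → AllPairs _<_ I →
  b ∷ c ∷ [] ⊆ D ++ m ∷ I → b < c
valley-⊆-above [] I _ m<b inc (_ ∷ʳ bc⊆) = increasing-⊆ inc bc⊆
valley-⊆-above [] I _ m<b inc (refl ∷ _) = ⊥-elim (<-irrefl refl m<b)
valley-⊆-above (d ∷ D) I (_ ∷ D<b) m<b inc (_ ∷ʳ bc⊆) = valley-⊆-above D I D<b m<b inc bc⊆
valley-⊆-above (d ∷ D) I (d<b ∷ _) m<b inc (refl ∷ _) = ⊥-elim (<-irrefl refl d<b)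

valley-peakFree : ∀ {D m I} → Valley D m I → PeakFree (D ++ m ∷ I)
valley-peakFree {[]} (valley _ inc _ m<I) abc⊆ a<b c<b =
  ⊥-elim (<-asym c<b (increasing-⊆ (m<I ∷ inc) (∷ˡ⁻ abc⊆)))
valley-peakFree {d ∷ D} (valley (_ ∷ dec) inc (_ ∷ m<D) m<I) (_ ∷ʳ abc⊆) a<b c<b =
  valley-peakFree (valley dec inc m<D m<I) abc⊆ a<b c<b
valley-peakFree {d ∷ D} {I = I} (valley (D<d ∷ _) inc (m<d ∷ _) _) (refl ∷ bc⊆) a<b c<b =
  ⊥-elim (<-asym c<b (valley-⊆-above D I (All.map (λ x<d → <-trans x<d a<b) D<d) (<-trans m<d a<b) inc bc⊆))

ValleyForm : List ℕ → Set
ValleyForm π = ∃ λ D → ∃₂ λ m I → π ≡ D ++ m ∷ I × Valley D m I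

peakFree⇒valley : ∀ x π → Unique (x ∷ π) → PeakFree (x ∷ π) → ValleyForm (x ∷ π)
peakFree⇒valley x [] _ _ = [] , x , [] , refl , valley [] [] [] []
peakFree⇒valley x (y ∷ π) (x∉ ∷ unique) peakFree
  with peakFree⇒valley y π unique (λ abc⊆ → peakFree (x ∷ʳ abc⊆))
... | D , m , I , y∷π≡ , v = extend D y∷π≡ v
  where
    m∈ : ∀ D → y ∷ π ≡ D ++ m ∷ I → m ∈ y ∷ π
    m∈ D eq = subst (m ∈_) (sym eq) (∈-++⁺ʳ D (here refl))
    extend : ∀ D → y ∷ π ≡ D ++ m ∷ I → Valley D m I → ValleyForm (x ∷ y ∷ π)
    extend [] eq (valley _ inc _ m<I) with <-cmp x m
    ... | tri< x<m _ _ = [] , x , m ∷ I , cong (x ∷_) eq ,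
                         valley [] (m<I ∷ inc) [] (x<m ∷ All.map (<-trans x<m) m<I)
    ... | tri≈ _ x≡m _ = ⊥-elim (All.lookup x∉ (m∈ [] eq) x≡m)
    ... | tri> _ _ m<x = x ∷ [] , m , I , cong (x ∷_) eq , valley ([] ∷ []) inc (m<x ∷ []) m<I
    extend (d ∷ D) eq (valley (D<d ∷ dec) inc (m<d ∷ m<D) m<I) with ∷-injective eq
    ... | refl , π≡ with <-cmp x d
    ...   | tri< x<d _ _ =
      ⊥-elim (All.lookup x∉ (m∈ (d ∷ D) eq)
        (peakFree (refl ∷ refl ∷ subst (m ∷ [] ⊆_) (sym π≡) m⊆) x<d m<d))
      where m⊆ = fromAny (∈-++⁺ʳ D (here refl))
    ...   | tri≈ _ x≡d _ = ⊥-elim (All.head x∉ x≡d)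
    ...   | tri> _ _ d<x = x ∷ d ∷ D , m , I , cong (x ∷_) eq ,
      valley ((d<x ∷ All.map (λ e<d → <-trans e<d d<x) D<d) ∷ D<d ∷ dec) inc (<-trans m<d d<x ∷ m<d ∷ m<D) m<I

Unique-resp-↭ : ∀ {xs ys : List ℕ} → xs ↭ ys → Unique xs → Unique ys
Unique-resp-↭ p = Permₛ.Unique-resp-↭ (setoid ℕ) (↭⇒↭ₛ p)

range-unique : ∀ n → Unique (range n)
range-unique n = Uniqueₚ.map⁺ suc-injective (Uniqueₚ.upTo⁺ n)

valleyOf-preimages : ∀ y → Preimages (decreasingPart y) 1 (increasingPart y)
valleyOf-preimages y = preimages _ _ 1 _ (n<1+n _) (valley-valleyOf y) (disjoint-valleyOf y)

preimage-↭ : ∀ {τ} y → s τ ≡ valleyOf y → τ ↭ range (suc (length y))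
preimage-↭ {τ} y sτ≡ = ↭-trans (↭-sym (s-↭ τ)) (↭-trans (↭-reflexive sτ≡) (valleyOf-↭ y))

dyck⇒uniquelySorted : ∀ y → DyckFrom 0 y → UniquelySorted (suc (length y)) (valleyOf y)
dyck⇒uniquelySorted y dyck =
  let ballot = ballotBy0⇒ballot (decreasingPart y) (increasingPart y) (dyck⇒ballotBy 0 y dyck)
      balanced = trans (dyck⇒length 0 y dyck) (+-identityʳ _)
      (σ , sσ≡ , only) = Preimages.unique-if-balanced (valleyOf-preimages y) ballot balanced
  in σ , (preimage-↭ y sσ≡ , sσ≡) , λ τ _ sτ≡ → only τ sτ≡

uniquelySorted⇒dyck : ∀ y → UniquelySorted (suc (length y)) (valleyOf y) → DyckFrom 0 y
uniquelySorted⇒dyck y (σ , (_ , sσ≡) , only) =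
  ballotBy⇒dyck 0 y (ballot⇒ballotBy0 (decreasingPart y) (increasingPart y) ballot)
    (trans balanced (sym (+-identityʳ _)))
  where
    P : Preimages (decreasingPart y) 1 (increasingPart y)
    P = valleyOf-preimages y
    v : Valley (decreasingPart y) 1 (increasingPart y)
    v = valley-valleyOf y
    ballot : Ballot (decreasingPart y) (increasingPart y)
    ballot = Preimages.ballot-necessary P σ sσ≡
    balanced : length (decreasingPart y) ≡ length (increasingPart y)
    balanced with m≤n⇒m<n∨m≡n (ballot⇒length≤ (Valley.left>min v) (Valley.right>min v) ballot)
    ... | inj₂ balanced = balanced
    ... | inj₁ shorter =
      let (τ₁ , τ₂ , sτ₁≡ , sτ₂≡ , τ₁≢τ₂) = Preimages.two-if-unbalanced P ballot shorter
      in ⊥-elim (τ₁≢τ₂ (trans (only τ₁ (preimage-↭ y sτ₁≡) sτ₁≡)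
                            (sym (only τ₂ (preimage-↭ y sτ₂≡) sτ₂≡))))

valleyOf-avoids-132 : ∀ y → Avoids (valleyOf y) p132
valleyOf-avoids-132 y = peakFree⇒avoids (valley-peakFree (valley-valleyOf y)) 1<3 2<3 (<⇒≢ 1<2)

valleyOf-avoids-231 : ∀ y → Avoids (valleyOf y) p231
valleyOf-avoids-231 y =
  peakFree⇒avoids (valley-peakFree (valley-valleyOf y)) 2<3 1<3 (λ 2≡1 → <⇒≢ 1<2 (sym 2≡1))

dyck⇒InU : ∀ y → DyckFrom 0 y → InU (suc (length y)) p132 p231 (valleyOf y)
dyck⇒InU y dyck = valleyOf-↭ y , dyck⇒uniquelySorted y dyck , valleyOf-avoids-132 y , valleyOf-avoids-231 y

InU⇒valleyOf : ∀ n π → InU (suc n) p132 p231 π → ∃ λ y → length y ≡ n × π ≡ valleyOf y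
InU⇒valleyOf n [] (perm , _) = ⊥-elim (0≢1+n (trans (↭-length perm) (length-range (suc n))))
InU⇒valleyOf n (x ∷ π) (perm , _ , avoid132 , avoid231) =
  let peakFree = avoids-132-231⇒peakFree (x ∷ π) avoid132 avoid231
      (D , m , I , π≡ , v) = peakFree⇒valley x π (Unique-resp-↭ (↭-sym perm) (range-unique (suc n))) peakFree
      (y , |y| , D≡ , m≡ , I≡) = decode n v (subst (_↭ range (suc n)) π≡ perm)
  in y , |y| , trans π≡ (cong₂ _++_ D≡ (cong₂ _∷_ m≡ I≡))

lemma8p2 : (k : ℕ) → HasCardinality (InU (suc (2 * k)) p132 p231) (catalan k)
lemma8p2 k =
  map valleyOf (dyckWords k 0) ,
  Uniqueₚ.map⁺ valleyOf-injective (dyckWords-unique k 0) ,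
  trans (length-map valleyOf (dyckWords k 0)) (length-dyckWords-catalan k) ,
  λ π → mk⇔ (sound π) (complete π)
  where
    2k≡k+k : 2 * k ≡ k + k
    2k≡k+k = cong (k +_) (+-identityʳ k)
    sound : ∀ π → π ∈ map valleyOf (dyckWords k 0) → InU (suc (2 * k)) p132 p231 π
    sound π π∈ with ∈-map⁻ valleyOf π∈
    ... | y , y∈ , refl =
      let (dyck , |y|) = ∈-dyckWords⁻ k 0 y y∈
      in subst (λ n → InU (suc n) p132 p231 (valleyOf y)) (trans |y| (sym 2k≡k+k)) (dyck⇒InU y dyck)
    complete : ∀ π → InU (suc (2 * k)) p132 p231 π → π ∈ map valleyOf (dyckWords k 0)
    complete π inU =
      let (y , |y| , π≡) = InU⇒valleyOf (2 * k) π inU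
          (_ , uniquelySorted , _) =
            subst (λ n → InU (suc n) p132 p231 (valleyOf y)) (sym |y|) (subst (InU _ p132 p231) π≡ inU)
          dyck = uniquelySorted⇒dyck y uniquelySorted
      in subst (_∈ map valleyOf (dyckWords k 0)) (sym π≡)
           (∈-map⁺ valleyOf (∈-dyckWords⁺ k 0 y dyck (trans |y| 2k≡k+k)))
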